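{- Let $n$ be a positive integer and let $t$ be an odd positive integer with $t \mid n$. If the hypercube $Q_{n/t}$ can be decomposed into paths of length $s$, then $Q_n$ can be decomposed into paths of length $ts$.
   Context: The $m$-dimensional hypercube $Q_m$ is the graph with vertex set $\{0,1\}^m$ in which two vertices $x,y$ are adjacent iff $\|x-y\|_1 = 1$. A path of length $k$ is a sequence of distinct vertices $x_1,\dots,x_{k+1}$ with $x_i x_{i+1}$ an edge for all $1\le i\le k$. A decomposition of a graph into paths of length $k$ is a collection of paths of length $k$ in the graph whose edge sets partition the edge set of the graph. -}

module Defs where

open import Data.Nat using (ℕ; zero; suc; _+_)
open import Data.Bool using (Bool; true; false; _xor_)
open import Data.Fin using (Fin; zero; suc; inject₁)
open import Data.Vec using (Vec; []; _∷_; lookup)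
open import Data.Product using (Σ; _×_; _,_)
open import Data.Sum using (_⊎_)
open import Relation.Binary.PropositionalEquality using (_≡_)

Vertex : ℕ → Set
Vertex m = Vec Bool m

hamming : ∀ {m} → Vertex m → Vertex m → ℕ
hamming [] [] = zero
hamming (a ∷ x) (b ∷ y) with a xor b
... | true  = suc (hamming x y)
... | false = hamming x y

Adjacent : ∀ {m} → Vertex m → Vertex m → Set
Adjacent x y = hamming x y ≡ 1

record Path (m k : ℕ) : Set where
  field
    vertex   : Vec (Vertex m) (suc k)
    distinct : ∀ (i j : Fin (suc k)) → lookup vertex i ≡ lookup vertex j → i ≡ j
    adjacent : ∀ (i : Fin k) → Adjacent (lookup vertex (inject₁ i)) (lookup vertex (suc i))
open Path public

EdgeAt : ∀ {m k} → Path m k → Fin k → Vertex m → Vertex m → Set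
EdgeAt P i x y =
  (lookup (vertex P) (inject₁ i) ≡ x × lookup (vertex P) (suc i) ≡ y)
  ⊎ (lookup (vertex P) (inject₁ i) ≡ y × lookup (vertex P) (suc i) ≡ x)

-- A finite family of paths (indexed by Fin N) whose edge sets partition E(Q_m):
-- every edge of Q_m is an edge of exactly one path of the family, exactly once
-- (and all path edges are edges of Q_m, by definition of a path).
IsPathDecomposition : ∀ {m k N} → (Fin N → Path m k) → Set
IsPathDecomposition {m} {k} {N} P =
  ∀ (x y : Vertex m) → Adjacent x y →
    Σ (Fin N) (λ j → Σ (Fin k) (λ i → EdgeAt (P j) i x y))
    × (∀ (j j′ : Fin N) (i i′ : Fin k) →
         EdgeAt (P j) i x y → EdgeAt (P j′) i′ x y → (j ≡ j′ × i ≡ i′))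

Decomposable : ℕ → ℕ → Set
Decomposable m k = Σ ℕ (λ N → Σ (Fin N → Path m k) IsPathDecomposition)

-- Identify Q_(tm) with (Q_m)^t, a vertex being t blocks of m coordinates. A path P of length s in
-- Q_m yields a path of length ts in Q_(tm), its zigzag: run through P in block 0, then through P
-- reversed in block 1, then P again in block 2, and so on, each block resting at the start of its
-- traversal before its turn and at the end afterwards. Because the directions alternate, the block
-- that has just finished rests where the next one starts, so at every moment the XOR of all blocks
-- but the moving one is one and the same vertex of Q_m. Translate the zigzag by a shift c whose
-- blocks XOR to that vertex; then along an edge moving block i, c_i is the XOR of the other blocks
-- of the endpoints. Hence an edge {x, y} of Q_(tm) moving block i determines c_i, then the edge
-- {x_i + c_i, y_i + c_i} of Q_m, then the path P_j containing it and finally all of c. So the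
-- translates of the zigzags of the paths of a decomposition of Q_m, by the 2^((t-1)m) admissible
-- shifts, decompose Q_(tm).

module Submission where

open import Defs
open import Data.Nat using (ℕ; zero; suc; _+_; _*_; _^_; _∸_; _⊓_; _/_; _≤_; _<_; s≤s; s≤s⁻¹; NonZero)
open import Data.Nat.DivMod using (m*n/n≡m)
open import Data.Nat.Divisibility using (_∣_; divides)
open import Data.Nat.Properties
  using (+-comm; +-suc; *-comm; *-suc; *-zeroʳ; +-monoʳ-≤; *-monoʳ-≤; ∸-monoˡ-≤; ≤-trans; <⇒≤; <-irrefl; <-cmp;
         m≤m+n; n≤1+n; m≢1+n+m; m+n∸m≡n; n∸n≡0; m≤n⇒m∸n≡0; m+n≤o⇒m≤o∸n; m⊓n≤n; m≤n⇒m⊓n≡m; m≥n⇒m⊓n≡n; ⊓-pres-m<;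
         module ≤-Reasoning)
open import Data.Fin using (Fin; zero; suc; toℕ; inject₁; fromℕ; fromℕ<; opposite; combine; _≟_)
import Data.Fin.Properties as Fin
open import Data.Fin.Properties
  using (suc-injective; toℕ-injective; toℕ<n; toℕ-fromℕ; toℕ-fromℕ<; toℕ-inject₁; inject₁-injective;
         opposite-involutive; toℕ-combine; combine-surjective; 2↔Bool; *↔×)
open import Data.Bool using (true; false; _xor_)
open import Data.Bool.Properties using (xor-assoc; xor-comm; xor-same; xor-identityʳ)
open import Data.Vec using (Vec; []; _∷_; _++_; zipWith; replicate; lookup; map; tabulate; concat; group; tail; _[_]≔_)
open import Data.Vec.Properties
  using (zipWith-assoc; zipWith-comm; zipWith-identityʳ; zipWith-++; ++-injective;
         lookup-map; lookup-zipWith; lookup∘tabulate; lookup∘update; lookup∘update′)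
open import Data.Vec.Relation.Binary.Pointwise.Extensional using (ext; Pointwise-≡⇒≡)
open import Data.Product using (Σ; _×_; _,_; proj₁; proj₂)
open import Data.Sum using (_⊎_; inj₁; inj₂)
open import Relation.Binary.PropositionalEquality
open import Relation.Nullary using (¬_; yes; no)
open import Relation.Binary using (tri<; tri≈; tri>)
open import Function using (_∘_)
open import Function.Bundles using (Inverse; _↔_; mk↔ₛ′)
open import Function.Properties.Inverse using (↔-refl; ↔-sym; ↔-trans)
open import Data.Product.Function.NonDependent.Propositional using (_×-↔_)
open import Data.Empty using (⊥-elim)

-- The hypercube as a group under XOR

infixl 6 _⊕_

_⊕_ : ∀ {m} → Vertex m → Vertex m → Vertex m
_⊕_ = zipWith _xor_

𝟎 : ∀ {m} → Vertex m
𝟎 = replicate _ false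

⊕-assoc : ∀ {m} (x y z : Vertex m) → x ⊕ y ⊕ z ≡ x ⊕ (y ⊕ z)
⊕-assoc = zipWith-assoc xor-assoc

⊕-comm : ∀ {m} (x y : Vertex m) → x ⊕ y ≡ y ⊕ x
⊕-comm = zipWith-comm xor-comm

⊕-identityʳ : ∀ {m} (x : Vertex m) → x ⊕ 𝟎 ≡ x
⊕-identityʳ = zipWith-identityʳ xor-identityʳ

⊕-self : ∀ {m} (x : Vertex m) → x ⊕ x ≡ 𝟎
⊕-self [] = refl
⊕-self (b ∷ x) = cong₂ _∷_ (xor-same b) (⊕-self x)

⊕-cancelʳ : ∀ {m} (x c : Vertex m) → x ⊕ c ⊕ c ≡ x
⊕-cancelʳ x c = trans (⊕-assoc x c c) (trans (cong (x ⊕_) (⊕-self c)) (⊕-identityʳ x))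

⊕-cancelˡ : ∀ {m} (c x : Vertex m) → c ⊕ (c ⊕ x) ≡ x
⊕-cancelˡ c x = trans (sym (⊕-assoc c c x)) (trans (cong (_⊕ x) (⊕-self c)) (trans (⊕-comm 𝟎 x) (⊕-identityʳ x)))

⊕-moveʳ : ∀ {m} {x c y : Vertex m} → x ⊕ c ≡ y → x ≡ y ⊕ c
⊕-moveʳ {x = x} {c} refl = sym (⊕-cancelʳ x c)

⊕-injectiveʳ : ∀ {m} {x y : Vertex m} (c : Vertex m) → x ⊕ c ≡ y ⊕ c → x ≡ y
⊕-injectiveʳ {y = y} c eq = trans (⊕-moveʳ eq) (⊕-cancelʳ y c)

⊕-injectiveˡ : ∀ {m} {x y : Vertex m} (c : Vertex m) → c ⊕ x ≡ c ⊕ y → x ≡ y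
⊕-injectiveˡ {x = x} {y} c eq = trans (sym (⊕-cancelˡ c x)) (trans (cong (c ⊕_) eq) (⊕-cancelˡ c y))

⊕-interchange : ∀ {m} (a b c d : Vertex m) → a ⊕ b ⊕ (c ⊕ d) ≡ a ⊕ c ⊕ (b ⊕ d)
⊕-interchange a b c d = begin
  a ⊕ b ⊕ (c ⊕ d)   ≡⟨ ⊕-assoc a b (c ⊕ d) ⟩
  a ⊕ (b ⊕ (c ⊕ d)) ≡⟨ cong (a ⊕_) (sym (⊕-assoc b c d)) ⟩
  a ⊕ (b ⊕ c ⊕ d)   ≡⟨ cong (λ z → a ⊕ (z ⊕ d)) (⊕-comm b c) ⟩
  a ⊕ (c ⊕ b ⊕ d)   ≡⟨ cong (a ⊕_) (⊕-assoc c b d) ⟩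
  a ⊕ (c ⊕ (b ⊕ d)) ≡⟨ sym (⊕-assoc a c (b ⊕ d)) ⟩
  a ⊕ c ⊕ (b ⊕ d)   ∎
  where open ≡-Reasoning

weight : ∀ {m} → Vertex m → ℕ
weight [] = 0
weight (true ∷ x) = suc (weight x)
weight (false ∷ x) = weight x

weight-++ : ∀ {a b} (x : Vertex a) (y : Vertex b) → weight (x ++ y) ≡ weight x + weight y
weight-++ [] y = refl
weight-++ (true ∷ x) y = cong suc (weight-++ x y)
weight-++ (false ∷ x) y = weight-++ x y

weight≡0⇒≡𝟎 : ∀ {m} (x : Vertex m) → weight x ≡ 0 → x ≡ 𝟎
weight≡0⇒≡𝟎 [] _ = refl
weight≡0⇒≡𝟎 (false ∷ x) w = cong (false ∷_) (weight≡0⇒≡𝟎 x w)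

weight-𝟎 : ∀ m → weight (𝟎 {m}) ≡ 0
weight-𝟎 zero = refl
weight-𝟎 (suc m) = weight-𝟎 m

hamming≡weight : ∀ {m} (x y : Vertex m) → hamming x y ≡ weight (x ⊕ y)
hamming≡weight [] [] = refl
hamming≡weight (true ∷ x) (true ∷ y) = hamming≡weight x y
hamming≡weight (true ∷ x) (false ∷ y) = cong suc (hamming≡weight x y)
hamming≡weight (false ∷ x) (true ∷ y) = cong suc (hamming≡weight x y)
hamming≡weight (false ∷ x) (false ∷ y) = hamming≡weight x y

hamming-⊕ : ∀ {m} (x y c : Vertex m) → hamming (x ⊕ c) (y ⊕ c) ≡ hamming x y
hamming-⊕ x y c = begin
  hamming (x ⊕ c) (y ⊕ c) ≡⟨ hamming≡weight (x ⊕ c) (y ⊕ c) ⟩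
  weight (x ⊕ c ⊕ (y ⊕ c)) ≡⟨ cong weight (⊕-interchange x c y c) ⟩
  weight (x ⊕ y ⊕ (c ⊕ c)) ≡⟨ cong (λ z → weight (x ⊕ y ⊕ z)) (⊕-self c) ⟩
  weight (x ⊕ y ⊕ 𝟎)       ≡⟨ cong weight (⊕-identityʳ (x ⊕ y)) ⟩
  weight (x ⊕ y)           ≡⟨ hamming≡weight x y ⟨
  hamming x y              ∎
  where open ≡-Reasoning

hamming-sym : ∀ {m} (x y : Vertex m) → hamming x y ≡ hamming y x
hamming-sym x y = trans (hamming≡weight x y) (trans (cong weight (⊕-comm x y)) (sym (hamming≡weight y x)))

hamming-self : ∀ {m} (x : Vertex m) → hamming x x ≡ 0
hamming-self {m} x = trans (hamming≡weight x x) (trans (cong weight (⊕-self x)) (weight-𝟎 m))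

hamming≡0⇒≡ : ∀ {m} (x y : Vertex m) → hamming x y ≡ 0 → x ≡ y
hamming≡0⇒≡ x y h = trans (⊕-moveʳ x⊕y≡𝟎) (trans (⊕-comm 𝟎 y) (⊕-identityʳ y))
  where
  x⊕y≡𝟎 : x ⊕ y ≡ 𝟎
  x⊕y≡𝟎 = weight≡0⇒≡𝟎 (x ⊕ y) (trans (sym (hamming≡weight x y)) h)

hamming-++ : ∀ {a b} (x y : Vertex a) (x′ y′ : Vertex b) →
             hamming (x ++ x′) (y ++ y′) ≡ hamming x y + hamming x′ y′
hamming-++ x y x′ y′ = begin
  hamming (x ++ x′) (y ++ y′)          ≡⟨ hamming≡weight (x ++ x′) (y ++ y′) ⟩
  weight ((x ++ x′) ⊕ (y ++ y′))       ≡⟨ cong weight (zipWith-++ _xor_ x x′ y y′) ⟩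
  weight ((x ⊕ y) ++ (x′ ⊕ y′))        ≡⟨ weight-++ (x ⊕ y) (x′ ⊕ y′) ⟩
  weight (x ⊕ y) + weight (x′ ⊕ y′)    ≡⟨ cong₂ _+_ (hamming≡weight x y) (hamming≡weight x′ y′) ⟨
  hamming x y + hamming x′ y′          ∎
  where open ≡-Reasoning

Adjacent-sym : ∀ {m} {x y : Vertex m} → Adjacent x y → Adjacent y x
Adjacent-sym {x = x} {y} = trans (hamming-sym y x)

Adjacent-⊕ : ∀ {m} {x y : Vertex m} (c : Vertex m) → Adjacent x y → Adjacent (x ⊕ c) (y ⊕ c)
Adjacent-⊕ {x = x} {y} c = trans (hamming-⊕ x y c)

Adjacent⇒≢ : ∀ {m} {x y : Vertex m} → Adjacent x y → x ≢ y
Adjacent⇒≢ {x = x} adj refl with trans (sym adj) (hamming-self x)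
... | ()

-- Paths: translation and reversal

SameEdge : ∀ {A : Set} → A → A → A → A → Set
SameEdge a b x y = (a ≡ x × b ≡ y) ⊎ (a ≡ y × b ≡ x)

sameEdge-cong : ∀ {A : Set} {a a′ b b′ x y : A} → a ≡ a′ → b ≡ b′ → SameEdge a b x y → SameEdge a′ b′ x y
sameEdge-cong refl refl e = e

sameEdge-swap : ∀ {A : Set} {a b x y : A} → SameEdge a b x y → SameEdge b a x y
sameEdge-swap (inj₁ (p , q)) = inj₂ (q , p)
sameEdge-swap (inj₂ (p , q)) = inj₁ (q , p)

sameEdge-map : ∀ {A B : Set} (f : A → B) {a b x y : A} → SameEdge a b x y → SameEdge (f a) (f b) (f x) (f y)
sameEdge-map f (inj₁ (p , q)) = inj₁ (cong f p , cong f q)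
sameEdge-map f (inj₂ (p , q)) = inj₂ (cong f p , cong f q)

sameEdge-injective : ∀ {A B : Set} {f : A → B} → (∀ {u v} → f u ≡ f v → u ≡ v) →
                     ∀ {a b x y} → SameEdge (f a) (f b) (f x) (f y) → SameEdge a b x y
sameEdge-injective f-inj (inj₁ (p , q)) = inj₁ (f-inj p , f-inj q)
sameEdge-injective f-inj (inj₂ (p , q)) = inj₂ (f-inj p , f-inj q)

sameEdge-⊕ : ∀ {m} {a b x y : Vertex m} (c : Vertex m) → SameEdge (a ⊕ c) (b ⊕ c) x y → SameEdge a b (x ⊕ c) (y ⊕ c)
sameEdge-⊕ {a = a} {b} c (inj₁ (refl , refl)) = inj₁ (sym (⊕-cancelʳ a c) , sym (⊕-cancelʳ b c))
sameEdge-⊕ {a = a} {b} c (inj₂ (refl , refl)) = inj₂ (sym (⊕-cancelʳ a c) , sym (⊕-cancelʳ b c))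

sameEdge-⊕⁻ : ∀ {m} {a b x y : Vertex m} (c : Vertex m) → SameEdge a b (x ⊕ c) (y ⊕ c) → SameEdge (a ⊕ c) (b ⊕ c) x y
sameEdge-⊕⁻ {x = x} {y} c (inj₁ (refl , refl)) = inj₁ (⊕-cancelʳ x c , ⊕-cancelʳ y c)
sameEdge-⊕⁻ {x = x} {y} c (inj₂ (refl , refl)) = inj₂ (⊕-cancelʳ y c , ⊕-cancelʳ x c)

opposite-injective : ∀ {n} {i j : Fin n} → opposite i ≡ opposite j → i ≡ j
opposite-injective {i = i} {j} eq = trans (sym (opposite-involutive i)) (trans (cong opposite eq) (opposite-involutive j))

opposite-inject₁ : ∀ {n} (i : Fin n) → opposite (inject₁ i) ≡ suc (opposite i)
opposite-inject₁ zero = refl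
opposite-inject₁ (suc i) = cong inject₁ (opposite-inject₁ i)

module _ {m k : ℕ} where

  first last : Path m k → Vertex m
  first Q = lookup (vertex Q) zero
  last Q = lookup (vertex Q) (fromℕ k)

  HasEdge : Path m k → Vertex m → Vertex m → Set
  HasEdge Q x y = Σ (Fin k) λ i → EdgeAt Q i x y

  private
    crossed : ∀ {i j : Fin k} → inject₁ i ≡ suc j → suc i ≢ inject₁ j
    crossed {i} {j} p q = m≢1+n+m (toℕ j) (begin
      toℕ j             ≡⟨ toℕ-inject₁ j ⟨
      toℕ (inject₁ j)   ≡⟨ cong toℕ q ⟨
      suc (toℕ i)       ≡⟨ cong suc (toℕ-inject₁ i) ⟨
      suc (toℕ (inject₁ i)) ≡⟨ cong (suc ∘ toℕ) p ⟩
      suc (suc (toℕ j)) ∎)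
      where open ≡-Reasoning

  edgeAt-unique : ∀ (Q : Path m k) {i j x y} → EdgeAt Q i x y → EdgeAt Q j x y → i ≡ j
  edgeAt-unique Q (inj₁ (a , _)) (inj₁ (a′ , _)) = inject₁-injective (distinct Q _ _ (trans a (sym a′)))
  edgeAt-unique Q (inj₂ (a , _)) (inj₂ (a′ , _)) = inject₁-injective (distinct Q _ _ (trans a (sym a′)))
  edgeAt-unique Q (inj₁ (a , b)) (inj₂ (a′ , b′)) =
    ⊥-elim (crossed (distinct Q _ _ (trans a (sym b′))) (distinct Q _ _ (trans b (sym a′))))
  edgeAt-unique Q (inj₂ (a , b)) (inj₁ (a′ , b′)) =
    ⊥-elim (crossed (distinct Q _ _ (trans a (sym b′))) (distinct Q _ _ (trans b (sym a′))))

  translate : Vertex m → Path m k → Path m k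
  translate c Q = record
    { vertex   = map (_⊕ c) (vertex Q)
    ; distinct = λ i j eq → distinct Q i j (⊕-injectiveʳ c (trans (sym (shifted i)) (trans eq (shifted j))))
    ; adjacent = λ i → subst₂ Adjacent (sym (shifted (inject₁ i))) (sym (shifted (suc i)))
                                       (Adjacent-⊕ {x = lookup (vertex Q) (inject₁ i)} c (adjacent Q i))
    }
    where
    shifted : ∀ i → lookup (map (_⊕ c) (vertex Q)) i ≡ lookup (vertex Q) i ⊕ c
    shifted i = lookup-map i (_⊕ c) (vertex Q)

  translate-edge : ∀ c Q {i x y} → EdgeAt Q i (x ⊕ c) (y ⊕ c) → EdgeAt (translate c Q) i x y
  translate-edge c Q {i} e =
    sameEdge-cong (sym (lookup-map (inject₁ i) (_⊕ c) (vertex Q))) (sym (lookup-map (suc i) (_⊕ c) (vertex Q)))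
                  (sameEdge-⊕⁻ c e)

  translate-edge⁻ : ∀ c Q {i x y} → EdgeAt (translate c Q) i x y → EdgeAt Q i (x ⊕ c) (y ⊕ c)
  translate-edge⁻ c Q {i} e =
    sameEdge-⊕ c (sameEdge-cong (lookup-map (inject₁ i) (_⊕ c) (vertex Q)) (lookup-map (suc i) (_⊕ c) (vertex Q)) e)

  reverse : Path m k → Path m k
  reverse Q = record
    { vertex   = tabulate (lookup (vertex Q) ∘ opposite)
    ; distinct = λ i j eq → opposite-injective (distinct Q _ _ (trans (sym (mirrored i)) (trans eq (mirrored j))))
    ; adjacent = λ i → subst₂ Adjacent (sym (trans (mirrored (inject₁ i)) (cong (lookup (vertex Q)) (opposite-inject₁ i))))
                                       (sym (mirrored (suc i)))
                                       (Adjacent-sym {x = lookup (vertex Q) (inject₁ (opposite i))} (adjacent Q (opposite i)))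
    }
    where
    mirrored : ∀ i → lookup (tabulate (lookup (vertex Q) ∘ opposite)) i ≡ lookup (vertex Q) (opposite i)
    mirrored = lookup∘tabulate (lookup (vertex Q) ∘ opposite)

  lookup-reverse : ∀ Q i → lookup (vertex (reverse Q)) i ≡ lookup (vertex Q) (opposite i)
  lookup-reverse Q = lookup∘tabulate (lookup (vertex Q) ∘ opposite)

  first-reverse : ∀ Q → first (reverse Q) ≡ last Q
  first-reverse Q = lookup-reverse Q zero

  private
    lookup-reverse-inject₁ : ∀ Q i → lookup (vertex (reverse Q)) (inject₁ i) ≡ lookup (vertex Q) (suc (opposite i))
    lookup-reverse-inject₁ Q i = trans (lookup-reverse Q (inject₁ i)) (cong (lookup (vertex Q)) (opposite-inject₁ i))

  reverse-edge : ∀ Q {i x y} → EdgeAt Q (opposite i) x y → EdgeAt (reverse Q) i x y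
  reverse-edge Q {i} e = sameEdge-cong (sym (lookup-reverse-inject₁ Q i)) (sym (lookup-reverse Q (suc i))) (sameEdge-swap e)

  reverse-edge⁻ : ∀ Q {i x y} → EdgeAt (reverse Q) i x y → EdgeAt Q (opposite i) x y
  reverse-edge⁻ Q {i} e = sameEdge-swap (sameEdge-cong (lookup-reverse-inject₁ Q i) (lookup-reverse Q (suc i)) e)

  reverse-hasEdge : ∀ Q {x y} → HasEdge Q x y → HasEdge (reverse Q) x y
  reverse-hasEdge Q {x} {y} (i , e) = opposite i , reverse-edge Q (subst (λ j → EdgeAt Q j x y) (sym (opposite-involutive i)) e)

  reverse-hasEdge⁻ : ∀ Q {x y} → HasEdge (reverse Q) x y → HasEdge Q x y
  reverse-hasEdge⁻ Q (i , e) = opposite i , reverse-edge⁻ Q e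

  alternate : ℕ → Path m k → Path m k
  alternate zero Q = Q
  alternate (suc n) Q = reverse (alternate n Q)

  alternate-hasEdge : ∀ n Q {x y} → HasEdge Q x y → HasEdge (alternate n Q) x y
  alternate-hasEdge zero Q e = e
  alternate-hasEdge (suc n) Q e = reverse-hasEdge (alternate n Q) (alternate-hasEdge n Q e)

  alternate-hasEdge⁻ : ∀ n Q {x y} → HasEdge (alternate n Q) x y → HasEdge Q x y
  alternate-hasEdge⁻ zero Q e = e
  alternate-hasEdge⁻ (suc n) Q e = alternate-hasEdge⁻ n Q (reverse-hasEdge⁻ (alternate n Q) e)

-- Vertices of Q_(tm) as t blocks of m coordinates

Blocks : ℕ → ℕ → Set
Blocks m t = Vec (Vertex m) t

EqualExcept : ∀ {A : Set} {t} → Fin t → Vec A t → Vec A t → Set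
EqualExcept i xs ys = ∀ k → k ≢ i → lookup xs k ≡ lookup ys k

lookup-extensional : ∀ {A : Set} {t} (xs ys : Vec A t) → (∀ k → lookup xs k ≡ lookup ys k) → xs ≡ ys
lookup-extensional _ _ eq = Pointwise-≡⇒≡ (ext eq)

sameEdge-update⁻ : ∀ {A : Set} {t} {K V W : Vec A t} {i a b} → SameEdge (K [ i ]≔ a) (K [ i ]≔ b) V W →
                   EqualExcept i V K × EqualExcept i W K × SameEdge a b (lookup V i) (lookup W i)
sameEdge-update⁻ {K = K} {i = i} {a} {b} (inj₁ (refl , refl)) =
  (λ k k≢i → lookup∘update′ k≢i K a) , (λ k k≢i → lookup∘update′ k≢i K b) ,
  inj₁ (sym (lookup∘update i K a) , sym (lookup∘update i K b))
sameEdge-update⁻ {K = K} {i = i} {a} {b} (inj₂ (refl , refl)) =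
  (λ k k≢i → lookup∘update′ k≢i K b) , (λ k k≢i → lookup∘update′ k≢i K a) ,
  inj₂ (sym (lookup∘update i K a) , sym (lookup∘update i K b))

equalExcept-unique : ∀ {A : Set} {t} {X Y : Vec A t} {i i′} → EqualExcept i X Y → EqualExcept i′ X Y → X ≢ Y → i ≡ i′
equalExcept-unique {X = X} {Y} {i} {i′} X≈Y X≈′Y X≢Y with i ≟ i′
... | yes i≡i′ = i≡i′
... | no i≢i′ = ⊥-elim (X≢Y (lookup-extensional X Y pointwise))
  where
  pointwise : ∀ k → lookup X k ≡ lookup Y k
  pointwise k with k ≟ i
  ... | yes refl = X≈′Y k i≢i′
  ... | no k≢i = X≈Y k k≢i

module _ {m : ℕ} where

  concat-injective : ∀ {t} (X Y : Blocks m t) → concat X ≡ concat Y → X ≡ Y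
  concat-injective [] [] _ = refl
  concat-injective (x ∷ X) (y ∷ Y) eq with ++-injective x y eq
  ... | x≡y , rest = cong₂ _∷_ x≡y (concat-injective X Y rest)

  concat-⊕ : ∀ {t} (X Y : Blocks m t) → concat X ⊕ concat Y ≡ concat (zipWith _⊕_ X Y)
  concat-⊕ [] [] = refl
  concat-⊕ (x ∷ X) (y ∷ Y) = trans (zipWith-++ _xor_ x (concat X) y (concat Y)) (cong (x ⊕ y ++_) (concat-⊕ X Y))

  concat-adjacent : ∀ {t} (K : Blocks m t) i {v w} → Adjacent v w → Adjacent (concat (K [ i ]≔ v)) (concat (K [ i ]≔ w))
  concat-adjacent (x ∷ K) zero {v} {w} adj = begin
    hamming (v ++ concat K) (w ++ concat K) ≡⟨ hamming-++ v w (concat K) (concat K) ⟩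
    hamming v w + hamming (concat K) (concat K) ≡⟨ cong₂ _+_ adj (hamming-self (concat K)) ⟩
    1 ∎
    where open ≡-Reasoning
  concat-adjacent (x ∷ K) (suc i) {v} {w} adj = begin
    hamming (x ++ concat (K [ i ]≔ v)) (x ++ concat (K [ i ]≔ w)) ≡⟨ hamming-++ x x _ _ ⟩
    hamming x x + hamming (concat (K [ i ]≔ v)) (concat (K [ i ]≔ w))
      ≡⟨ cong₂ _+_ (hamming-self x) (concat-adjacent K i adj) ⟩
    1 ∎
    where open ≡-Reasoning

  private
    +≡1 : ∀ a {b} → a + b ≡ 1 → (a ≡ 1 × b ≡ 0) ⊎ (a ≡ 0 × b ≡ 1)
    +≡1 zero eq = inj₂ (refl , eq)
    +≡1 (suc zero) {zero} _ = inj₁ (refl , refl)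
    +≡1 (suc zero) {suc b} ()
    +≡1 (suc (suc a)) ()

  concat-adjacent⁻ : ∀ {t} (X Y : Blocks m t) → Adjacent (concat X) (concat Y) →
                     Σ (Fin t) λ i → Adjacent (lookup X i) (lookup Y i) × EqualExcept i X Y
  concat-adjacent⁻ [] [] ()
  concat-adjacent⁻ (x ∷ X) (y ∷ Y) adj
    with +≡1 (hamming x y) (trans (sym (hamming-++ x y (concat X) (concat Y))) adj)
  ... | inj₁ (adj₀ , same) = zero , adj₀ , λ where
          zero 0≢0 → ⊥-elim (0≢0 refl)
          (suc k) _ → cong (λ Z → lookup Z k) (concat-injective X Y (hamming≡0⇒≡ (concat X) (concat Y) same))
  ... | inj₂ (same , adj′) with concat-adjacent⁻ X Y adj′
  ...   | i , adjᵢ , rest = suc i , adjᵢ , λ where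
          zero _ → hamming≡0⇒≡ x y same
          (suc k) k≢i → rest k (k≢i ∘ cong suc)

  ⨁ : ∀ {t} → Blocks m t → Vertex m
  ⨁ [] = 𝟎
  ⨁ (x ∷ X) = x ⊕ ⨁ X

  ⨁-except : ∀ {t} → Blocks m t → Fin t → Vertex m
  ⨁-except X i = ⨁ X ⊕ lookup X i

  ⨁-zipWith : ∀ {t} (X Y : Blocks m t) → ⨁ (zipWith _⊕_ X Y) ≡ ⨁ X ⊕ ⨁ Y
  ⨁-zipWith [] [] = sym (⊕-identityʳ 𝟎)
  ⨁-zipWith (x ∷ X) (y ∷ Y) = trans (cong (x ⊕ y ⊕_) (⨁-zipWith X Y)) (⊕-interchange x y (⨁ X) (⨁ Y))

  ⨁-except-zipWith : ∀ {t} (X Y : Blocks m t) i → ⨁-except (zipWith _⊕_ X Y) i ≡ ⨁-except X i ⊕ ⨁-except Y i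
  ⨁-except-zipWith X Y i = begin
    ⨁ (zipWith _⊕_ X Y) ⊕ lookup (zipWith _⊕_ X Y) i ≡⟨ cong₂ _⊕_ (⨁-zipWith X Y) (lookup-zipWith _⊕_ i X Y) ⟩
    ⨁ X ⊕ ⨁ Y ⊕ (lookup X i ⊕ lookup Y i)             ≡⟨ ⊕-interchange (⨁ X) (⨁ Y) (lookup X i) (lookup Y i) ⟩
    ⨁-except X i ⊕ ⨁-except Y i                        ∎
    where open ≡-Reasoning

  ⨁-except-cong : ∀ {t} (X Y : Blocks m t) i → EqualExcept i X Y → ⨁-except X i ≡ ⨁-except Y i
  ⨁-except-cong (x ∷ X) (y ∷ Y) zero eq = begin
    x ⊕ ⨁ X ⊕ x ≡⟨ cong (_⊕ x) (⊕-comm x (⨁ X)) ⟩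
    ⨁ X ⊕ x ⊕ x ≡⟨ ⊕-cancelʳ (⨁ X) x ⟩
    ⨁ X         ≡⟨ cong ⨁ (lookup-extensional X Y λ k → eq (suc k) λ ()) ⟩
    ⨁ Y         ≡⟨ ⊕-cancelʳ (⨁ Y) y ⟨
    ⨁ Y ⊕ y ⊕ y ≡⟨ cong (_⊕ y) (⊕-comm (⨁ Y) y) ⟩
    y ⊕ ⨁ Y ⊕ y ∎
    where open ≡-Reasoning
  ⨁-except-cong (x ∷ X) (y ∷ Y) (suc i) eq = begin
    x ⊕ ⨁ X ⊕ lookup X i   ≡⟨ ⊕-assoc x (⨁ X) (lookup X i) ⟩
    x ⊕ ⨁-except X i       ≡⟨ cong₂ _⊕_ (eq zero λ ()) (⨁-except-cong X Y i λ k → eq (suc k) ∘ (_∘ suc-injective)) ⟩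
    y ⊕ ⨁-except Y i       ≡⟨ ⊕-assoc y (⨁ Y) (lookup Y i) ⟨
    y ⊕ ⨁ Y ⊕ lookup Y i   ∎
    where open ≡-Reasoning

  ⨁-except-update : ∀ {t} (X : Blocks m t) i v → ⨁-except (X [ i ]≔ v) i ≡ ⨁-except X i
  ⨁-except-update X i v = ⨁-except-cong (X [ i ]≔ v) X i λ k k≢i → lookup∘update′ k≢i X v

  ⨁-determines : ∀ {t} {X Y : Blocks m t} i → EqualExcept i X Y → ⨁ X ≡ ⨁ Y → X ≡ Y
  ⨁-determines {X = X} {Y} i eq ⨁≡ = lookup-extensional X Y pointwise
    where
    pointwise : ∀ k → lookup X k ≡ lookup Y k
    pointwise k with k ≟ i
    ... | yes refl = ⊕-injectiveˡ (⨁ Y) (trans (cong (_⊕ lookup X k) (sym ⨁≡)) (⨁-except-cong X Y k eq))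
    ... | no k≢i = eq k k≢i

-- Running through t paths one block after the other

module _ (s : ℕ) {i k : ℕ} where

  s≤s*i∸s*k : k < i → s ≤ s * i ∸ s * k
  s≤s*i∸s*k k<i = m+n≤o⇒m≤o∸n s (subst (_≤ s * i) (*-suc s k) (*-monoʳ-≤ s k<i))

  s*i+r≤s*k : ∀ {r} → i < k → r ≤ s → s * i + r ≤ s * k
  s*i+r≤s*k {r} i<k r≤s = begin
    s * i + r ≤⟨ +-monoʳ-≤ (s * i) r≤s ⟩
    s * i + s ≡⟨ +-comm (s * i) s ⟩
    s + s * i ≡⟨ *-suc s i ⟨
    s * suc i ≤⟨ *-monoʳ-≤ s i<k ⟩
    s * k     ∎
    where open ≤-Reasoning

module Serial {m s t : ℕ} (Q : ℕ → Path m s) where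

  node : ℕ → Fin (suc s) → Vertex m
  node n = lookup (vertex (Q n))

  clamp : ℕ → Fin (suc s)
  clamp ρ = fromℕ< (s≤s (m⊓n≤n ρ s))

  toℕ-clamp : ∀ ρ → toℕ (clamp ρ) ≡ ρ ⊓ s
  toℕ-clamp ρ = toℕ-fromℕ< (s≤s (m⊓n≤n ρ s))

  clamp-toℕ : ∀ (r : Fin (suc s)) → clamp (toℕ r) ≡ r
  clamp-toℕ r = toℕ-injective (trans (toℕ-clamp (toℕ r)) (m≤n⇒m⊓n≡m (s≤s⁻¹ (toℕ<n r))))

  clamp-≥ : ∀ {ρ} → s ≤ ρ → clamp ρ ≡ fromℕ s
  clamp-≥ {ρ} s≤ρ = toℕ-injective (trans (toℕ-clamp ρ) (trans (m≥n⇒m⊓n≡n s≤ρ) (sym (toℕ-fromℕ s))))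

  clamp-stable : ∀ {i k r} → k ≢ i → r ≤ s → clamp (s * i + r ∸ s * k) ≡ clamp (s * i ∸ s * k)
  clamp-stable {i} {k} {r} k≢i r≤s with <-cmp k i
  ... | tri< k<i _ _ = trans (clamp-≥ (≤-trans (s≤s*i∸s*k s k<i) (∸-monoˡ-≤ (s * k) (m≤m+n (s * i) r))))
                             (sym (clamp-≥ (s≤s*i∸s*k s k<i)))
  ... | tri≈ _ k≡i _ = ⊥-elim (k≢i k≡i)
  ... | tri> _ _ i<k = cong clamp (trans (m≤n⇒m∸n≡0 late) (sym (m≤n⇒m∸n≡0 (≤-trans (m≤m+n (s * i) r) late))))
    where late = s*i+r≤s*k s i<k r≤s

  -- Truncated subtraction and clamp keep block k at the first vertex of Q k before time s k,
  -- and at its last vertex from time s (k + 1) on.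
  blocksAt : ℕ → Blocks m t
  blocksAt q = tabulate λ k → node (toℕ k) (clamp (q ∸ s * toℕ k))

  lookup-blocksAt : ∀ q k → lookup (blocksAt q) k ≡ node (toℕ k) (clamp (q ∸ s * toℕ k))
  lookup-blocksAt q = lookup∘tabulate _

  lookup-corner : ∀ {n} (i : Fin t) → toℕ i ≡ n → lookup (blocksAt (s * n)) i ≡ first (Q n)
  lookup-corner i refl = trans (lookup-blocksAt (s * toℕ i) i) (cong (node (toℕ i) ∘ clamp) (n∸n≡0 (s * toℕ i)))

  phase : ∀ {n} (i : Fin t) → toℕ i ≡ n → (r : Fin (suc s)) →
          blocksAt (s * n + toℕ r) ≡ blocksAt (s * n) [ i ]≔ node n r
  phase i refl r = lookup-extensional _ _ pointwise
    where
    si = s * toℕ i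
    pointwise : ∀ k → lookup (blocksAt (si + toℕ r)) k ≡ lookup (blocksAt si [ i ]≔ node (toℕ i) r) k
    pointwise k with k ≟ i
    ... | yes refl = begin
      lookup (blocksAt (si + toℕ r)) i         ≡⟨ lookup-blocksAt _ i ⟩
      node (toℕ i) (clamp (si + toℕ r ∸ si))   ≡⟨ cong (node (toℕ i) ∘ clamp) (m+n∸m≡n si (toℕ r)) ⟩
      node (toℕ i) (clamp (toℕ r))             ≡⟨ cong (node (toℕ i)) (clamp-toℕ r) ⟩
      node (toℕ i) r                           ≡⟨ lookup∘update i (blocksAt si) _ ⟨
      lookup (blocksAt si [ i ]≔ node (toℕ i) r) i ∎
      where open ≡-Reasoning
    ... | no k≢i = begin
      lookup (blocksAt (si + toℕ r)) k
        ≡⟨ lookup-blocksAt _ k ⟩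
      node (toℕ k) (clamp (si + toℕ r ∸ s * toℕ k))
        ≡⟨ cong (node (toℕ k)) (clamp-stable (k≢i ∘ toℕ-injective) (s≤s⁻¹ (toℕ<n r))) ⟩
      node (toℕ k) (clamp (si ∸ s * toℕ k))
        ≡⟨ lookup-blocksAt _ k ⟨
      lookup (blocksAt si) k
        ≡⟨ lookup∘update′ k≢i (blocksAt si) _ ⟨
      lookup (blocksAt si [ i ]≔ node (toℕ i) r) k ∎
      where open ≡-Reasoning

  corner : Fin t → Blocks m t
  corner i = blocksAt (s * toℕ i)

  quotRem : ∀ {a} → a < t * s → Σ (Fin t) λ i → Σ (Fin s) λ r → s * toℕ i + toℕ r ≡ a
  quotRem {a} a<ts with combine-surjective {t} {s} (fromℕ< a<ts)
  ... | i , r , eq = i , r , trans (sym (toℕ-combine i r)) (trans (cong toℕ eq) (toℕ-fromℕ< a<ts))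

  blocksAt-injective : ∀ {a b} → a < b → a < t * s → blocksAt a ≢ blocksAt b
  blocksAt-injective {b = b} a<b a<ts eq with quotRem a<ts
  ... | i , r , refl = <-irrefl r≡ r<
    where
    Qᵢ = Q (toℕ i)
    si = s * toℕ i
    same-index : clamp (si + toℕ r ∸ si) ≡ clamp (b ∸ si)
    same-index = distinct Qᵢ _ _ (trans (sym (lookup-blocksAt _ i)) (trans (cong (λ X → lookup X i) eq) (lookup-blocksAt b i)))
    r≡ : toℕ r ≡ (b ∸ si) ⊓ s
    r≡ = begin
      toℕ r                    ≡⟨ m≤n⇒m⊓n≡m (<⇒≤ (toℕ<n r)) ⟨
      toℕ r ⊓ s                ≡⟨ cong (_⊓ s) (m+n∸m≡n si (toℕ r)) ⟨
      (si + toℕ r ∸ si) ⊓ s    ≡⟨ toℕ-clamp _ ⟨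
      toℕ (clamp (si + toℕ r ∸ si)) ≡⟨ cong toℕ same-index ⟩
      toℕ (clamp (b ∸ si))     ≡⟨ toℕ-clamp _ ⟩
      (b ∸ si) ⊓ s             ∎
      where open ≡-Reasoning
    r< : toℕ r < (b ∸ si) ⊓ s
    r< = ⊓-pres-m< (m+n≤o⇒m≤o∸n (suc (toℕ r)) (subst (_≤ b) (cong suc (+-comm si (toℕ r))) a<b)) (toℕ<n r)

  vertices : Vec (Vertex (t * m)) (suc (t * s))
  vertices = tabulate (concat ∘ blocksAt ∘ toℕ)

  lookup-vertices : ∀ q → lookup vertices q ≡ concat (blocksAt (toℕ q))
  lookup-vertices = lookup∘tabulate (concat ∘ blocksAt ∘ toℕ)

  vertices-inject₁ : ∀ i r → lookup vertices (inject₁ (combine i r)) ≡ concat (corner i [ i ]≔ node (toℕ i) (inject₁ r))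
  vertices-inject₁ i r = begin
    lookup vertices (inject₁ (combine i r))         ≡⟨ lookup-vertices (inject₁ (combine i r)) ⟩
    concat (blocksAt (toℕ (inject₁ (combine i r)))) ≡⟨ cong (concat ∘ blocksAt) (toℕ-inject₁ (combine i r)) ⟩
    concat (blocksAt (toℕ (combine i r)))           ≡⟨ cong (concat ∘ blocksAt) (toℕ-combine i r) ⟩
    concat (blocksAt (s * toℕ i + toℕ r))           ≡⟨ cong (concat ∘ blocksAt ∘ (s * toℕ i +_)) (toℕ-inject₁ r) ⟨
    concat (blocksAt (s * toℕ i + toℕ (inject₁ r))) ≡⟨ cong concat (phase i refl (inject₁ r)) ⟩
    concat (corner i [ i ]≔ node (toℕ i) (inject₁ r)) ∎
    where open ≡-Reasoning

  vertices-suc : ∀ i r → lookup vertices (suc (combine i r)) ≡ concat (corner i [ i ]≔ node (toℕ i) (suc r))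
  vertices-suc i r = begin
    lookup vertices (suc (combine i r))         ≡⟨ lookup-vertices (suc (combine i r)) ⟩
    concat (blocksAt (suc (toℕ (combine i r)))) ≡⟨ cong (concat ∘ blocksAt ∘ suc) (toℕ-combine i r) ⟩
    concat (blocksAt (suc (s * toℕ i + toℕ r))) ≡⟨ cong (concat ∘ blocksAt) (+-suc (s * toℕ i) (toℕ r)) ⟨
    concat (blocksAt (s * toℕ i + suc (toℕ r))) ≡⟨ cong concat (phase i refl (suc r)) ⟩
    concat (corner i [ i ]≔ node (toℕ i) (suc r)) ∎
    where open ≡-Reasoning

  serial : Path (t * m) (t * s)
  serial = record { vertex = vertices ; distinct = injective ; adjacent = adjacent′ }
    where
    blocks-injective : ∀ {a b} → toℕ a < toℕ b → lookup vertices a ≢ lookup vertices b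
    blocks-injective {a} {b} a<b eq =
      blocksAt-injective a<b (≤-trans a<b (s≤s⁻¹ (toℕ<n b)))
        (concat-injective _ _ (trans (sym (lookup-vertices a)) (trans eq (lookup-vertices b))))
    injective : ∀ a b → lookup vertices a ≡ lookup vertices b → a ≡ b
    injective a b eq with Fin.<-cmp a b
    ... | tri< a<b _ _ = ⊥-elim (blocks-injective a<b eq)
    ... | tri≈ _ a≡b _ = a≡b
    ... | tri> _ _ b<a = ⊥-elim (blocks-injective b<a (sym eq))
    adjacent′ : ∀ e → Adjacent (lookup vertices (inject₁ e)) (lookup vertices (suc e))
    adjacent′ e with combine-surjective {t} {s} e
    ... | i , r , refl = subst₂ Adjacent (sym (vertices-inject₁ i r)) (sym (vertices-suc i r))
                                 (concat-adjacent (corner i) i (adjacent (Q (toℕ i)) r))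

  serial-edge : ∀ i r {x y} → SameEdge (concat (corner i [ i ]≔ node (toℕ i) (inject₁ r)))
                                        (concat (corner i [ i ]≔ node (toℕ i) (suc r))) x y →
                EdgeAt serial (combine i r) x y
  serial-edge i r = sameEdge-cong (sym (vertices-inject₁ i r)) (sym (vertices-suc i r))

  serial-edge⁻ : ∀ i r {x y} → EdgeAt serial (combine i r) x y →
                 SameEdge (concat (corner i [ i ]≔ node (toℕ i) (inject₁ r)))
                          (concat (corner i [ i ]≔ node (toℕ i) (suc r))) x y
  serial-edge⁻ i r = sameEdge-cong (vertices-inject₁ i r) (vertices-suc i r)

  Chained : Set
  Chained = ∀ n → first (Q (suc n)) ≡ last (Q n)

  ⨁-blocksAt : Chained → ∀ n → n < t → ⨁ (blocksAt (s * n)) ⊕ first (Q n) ≡ ⨁ (blocksAt 0) ⊕ first (Q 0)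
  ⨁-blocksAt chained zero _ = cong (λ q → ⨁ (blocksAt q) ⊕ first (Q 0)) (*-zeroʳ s)
  ⨁-blocksAt chained (suc n) 1+n<t = begin
    ⨁ (blocksAt (s * suc n)) ⊕ first (Q (suc n))
      ≡⟨ cong₂ (λ q v → ⨁ (blocksAt q) ⊕ v) s*[1+n]≡s*n+s (chained n) ⟩
    ⨁ (blocksAt (s * n + toℕ (fromℕ s))) ⊕ last (Q n)
      ≡⟨ cong (λ X → ⨁ X ⊕ last (Q n)) (phase i (toℕ-fromℕ< n<t) (fromℕ s)) ⟩
    ⨁ (blocksAt (s * n) [ i ]≔ last (Q n)) ⊕ last (Q n)
      ≡⟨ cong (⨁ (blocksAt (s * n) [ i ]≔ last (Q n)) ⊕_) (lookup∘update i (blocksAt (s * n)) _) ⟨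
    ⨁-except (blocksAt (s * n) [ i ]≔ last (Q n)) i
      ≡⟨ ⨁-except-update (blocksAt (s * n)) i (last (Q n)) ⟩
    ⨁ (blocksAt (s * n)) ⊕ lookup (blocksAt (s * n)) i
      ≡⟨ cong (⨁ (blocksAt (s * n)) ⊕_) (lookup-corner i (toℕ-fromℕ< n<t)) ⟩
    ⨁ (blocksAt (s * n)) ⊕ first (Q n)
      ≡⟨ ⨁-blocksAt chained n n<t ⟩
    ⨁ (blocksAt 0) ⊕ first (Q 0)
      ∎
    where
    open ≡-Reasoning
    n<t : n < t
    n<t = ≤-trans (n≤1+n (suc n)) 1+n<t
    i : Fin t
    i = fromℕ< n<t
    s*[1+n]≡s*n+s : s * suc n ≡ s * n + toℕ (fromℕ s)
    s*[1+n]≡s*n+s = trans (*-suc s n) (trans (+-comm s (s * n)) (cong (s * n +_) (sym (toℕ-fromℕ s))))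

  ⨁-except-corner : Chained → ∀ i → ⨁-except (corner i) i ≡ ⨁ (blocksAt 0) ⊕ first (Q 0)
  ⨁-except-corner chained i = trans (cong (⨁ (corner i) ⊕_) (lookup-corner i refl)) (⨁-blocksAt chained (toℕ i) (toℕ<n i))

IsDecomposition : ∀ {m k} {I : Set} → (I → Path m k) → Set
IsDecomposition {m} {k} {I} P =
  ∀ (x y : Vertex m) → Adjacent x y →
    Σ I (λ j → Σ (Fin k) (λ i → EdgeAt (P j) i x y))
    × (∀ (j j′ : I) (i i′ : Fin k) → EdgeAt (P j) i x y → EdgeAt (P j′) i′ x y → (j ≡ j′ × i ≡ i′))

isDecomposition⇒decomposable : ∀ {m k M} {I : Set} {P : I → Path m k} → I ↔ Fin M → IsDecomposition P → Decomposable m k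
isDecomposition⇒decomposable {M = M} {P = P} I↔Fin D = M , P ∘ from , λ x y adj → covered x y adj , coveredOnce x y adj
  where
  open Inverse I↔Fin
  covered : ∀ x y → Adjacent x y → Σ (Fin M) λ ι → Σ _ λ e → EdgeAt (P (from ι)) e x y
  covered x y adj with proj₁ (D x y adj)
  ... | j , e , o = to j , e , subst (λ j → EdgeAt (P j) e x y) (sym (strictlyInverseʳ j)) o
  coveredOnce : ∀ x y → Adjacent x y → ∀ ι ι′ e e′ →
                EdgeAt (P (from ι)) e x y → EdgeAt (P (from ι′)) e′ x y → ι ≡ ι′ × e ≡ e′
  coveredOnce x y adj ι ι′ e e′ o o′ with proj₂ (D x y adj) (from ι) (from ι′) e e′ o o′
  ... | same , e≡e′ = trans (sym (strictlyInverseˡ ι)) (trans (cong to same) (strictlyInverseˡ ι′)) , e≡e′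

Vec↔Fin^ : ∀ {A : Set} {k} → A ↔ Fin k → ∀ n → Vec A n ↔ Fin (k ^ n)
Vec↔Fin^ A↔Fin zero = mk↔ₛ′ (λ _ → zero) (λ _ → []) (λ { zero → refl }) (λ { [] → refl })
Vec↔Fin^ {A} A↔Fin (suc n) = ↔-trans uncons (↔-trans (A↔Fin ×-↔ Vec↔Fin^ A↔Fin n) (↔-sym *↔×))
  where
  uncons : Vec A (suc n) ↔ (A × Vec A n)
  uncons = mk↔ₛ′ (λ { (x ∷ xs) → x , xs }) (λ (x , xs) → x ∷ xs) (λ _ → refl) (λ { (x ∷ xs) → refl })

-- The zigzag decomposition

module Zigzag {m s t : ℕ} (P : Path m s) where

  open Serial {m} {s} {t} (λ n → alternate n P) public

  zigzag : Path (t * m) (t * s)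
  zigzag = serial

  chained : Chained
  chained n = first-reverse (alternate n P)

  cornerSum : Vertex m
  cornerSum = ⨁ (blocksAt 0) ⊕ first P

  shiftFor : Fin t → Blocks m t → Blocks m t
  shiftFor i X = zipWith _⊕_ X (corner i) [ i ]≔ ⨁-except X i

  lookup-shiftFor : ∀ {i k} X → k ≢ i → lookup (shiftFor i X) k ≡ lookup X k ⊕ lookup (corner i) k
  lookup-shiftFor {i} {k} X k≢i = trans (lookup∘update′ k≢i (zipWith _⊕_ X (corner i)) _) (lookup-zipWith _⊕_ k X (corner i))

  ⨁-shiftFor : ∀ i X → ⨁ (shiftFor i X) ≡ cornerSum
  ⨁-shiftFor i X = begin
    ⨁ c                  ≡⟨ ⊕-moveʳ ⨁c⊕κ ⟩
    κ ⊕ cornerSum ⊕ κ            ≡⟨ cong (_⊕ κ) (⊕-comm κ cornerSum) ⟩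
    cornerSum ⊕ κ ⊕ κ            ≡⟨ ⊕-cancelʳ cornerSum κ ⟩
    cornerSum                    ∎
    where
    open ≡-Reasoning
    c = shiftFor i X
    κ = ⨁-except X i
    ⨁c⊕κ : ⨁ c ⊕ κ ≡ κ ⊕ cornerSum
    ⨁c⊕κ = begin
      ⨁ c ⊕ κ                                ≡⟨ cong (⨁ c ⊕_) (lookup∘update i (zipWith _⊕_ X (corner i)) κ) ⟨
      ⨁-except c i                           ≡⟨ ⨁-except-update (zipWith _⊕_ X (corner i)) i κ ⟩
      ⨁-except (zipWith _⊕_ X (corner i)) i  ≡⟨ ⨁-except-zipWith X (corner i) i ⟩
      κ ⊕ ⨁-except (corner i) i              ≡⟨ cong (κ ⊕_) (⨁-except-corner chained i) ⟩
      κ ⊕ cornerSum                                  ∎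

  translate-zigzag-edge : ∀ {i r} {X Y : Blocks m t} → EqualExcept i X Y →
             EdgeAt (alternate (toℕ i) P) r (lookup X i ⊕ ⨁-except X i) (lookup Y i ⊕ ⨁-except X i) →
             EdgeAt (translate (concat (shiftFor i X)) zigzag) (combine i r) (concat X) (concat Y)
  translate-zigzag-edge {i} {r} {X} {Y} X≈Y e =
    translate-edge (concat c) zigzag
      (serial-edge i r (subst₂ (SameEdge _ _) (shifted X λ _ _ → refl) (shifted Y X≈Y)
                                              (sameEdge-map (concat ∘ (corner i [ i ]≔_)) e)))
    where
    c = shiftFor i X
    κ = ⨁-except X i
    shifted : ∀ Z → EqualExcept i X Z → concat (corner i [ i ]≔ (lookup Z i ⊕ κ)) ≡ concat Z ⊕ concat c
    shifted Z X≈Z =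
      trans (cong concat (lookup-extensional (corner i [ i ]≔ (lookup Z i ⊕ κ)) (zipWith _⊕_ Z c) pointwise))
            (sym (concat-⊕ Z c))
      where
      pointwise : ∀ k → lookup (corner i [ i ]≔ (lookup Z i ⊕ κ)) k ≡ lookup (zipWith _⊕_ Z c) k
      pointwise k with k ≟ i
      ... | yes refl = begin
        lookup (corner k [ k ]≔ (lookup Z k ⊕ κ)) k ≡⟨ lookup∘update k (corner k) _ ⟩
        lookup Z k ⊕ κ                            ≡⟨ cong (lookup Z k ⊕_) (lookup∘update k (zipWith _⊕_ X (corner k)) κ) ⟨
        lookup Z k ⊕ lookup c k                   ≡⟨ lookup-zipWith _⊕_ k Z c ⟨
        lookup (zipWith _⊕_ Z c) k                ∎
        where open ≡-Reasoning
      ... | no k≢i = begin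
        lookup (corner i [ i ]≔ (lookup Z i ⊕ κ)) k     ≡⟨ lookup∘update′ k≢i (corner i) _ ⟩
        lookup (corner i) k                             ≡⟨ ⊕-cancelˡ (lookup Z k) (lookup (corner i) k) ⟨
        lookup Z k ⊕ (lookup Z k ⊕ lookup (corner i) k) ≡⟨ cong (λ v → lookup Z k ⊕ (v ⊕ lookup (corner i) k)) (X≈Z k k≢i) ⟨
        lookup Z k ⊕ (lookup X k ⊕ lookup (corner i) k) ≡⟨ cong (lookup Z k ⊕_) (lookup-shiftFor X k≢i) ⟨
        lookup Z k ⊕ lookup c k                         ≡⟨ lookup-zipWith _⊕_ k Z c ⟨
        lookup (zipWith _⊕_ Z c) k                      ∎
        where open ≡-Reasoning

  translate-zigzag-edge⁻ : ∀ {i r} {X Y c : Blocks m t} → ⨁ c ≡ cornerSum →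
              EdgeAt (translate (concat c) zigzag) (combine i r) (concat X) (concat Y) →
              EqualExcept i X Y × c ≡ shiftFor i X ×
              EdgeAt (alternate (toℕ i) P) r (lookup X i ⊕ ⨁-except X i) (lookup Y i ⊕ ⨁-except X i)
  translate-zigzag-edge⁻ {i} {r} {X} {Y} {c} ⨁c≡ o =
    X≈Y , c≡shiftFor , subst₂ (EdgeAt (alternate (toℕ i) P) r) (X⊕c′ X) (X⊕c′ Y) moving
    where
    o′ : SameEdge (corner i [ i ]≔ _) (corner i [ i ]≔ _) (zipWith _⊕_ X c) (zipWith _⊕_ Y c)
    o′ = sameEdge-injective (concat-injective _ _)
           (subst₂ (SameEdge _ _) (concat-⊕ X c) (concat-⊕ Y c) (serial-edge⁻ i r (translate-edge⁻ (concat c) zigzag o)))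
    V≈K = proj₁ (sameEdge-update⁻ o′)
    W≈K = proj₁ (proj₂ (sameEdge-update⁻ o′))
    moving = proj₂ (proj₂ (sameEdge-update⁻ o′))
    X⊕c≈K : ∀ k → k ≢ i → lookup X k ⊕ lookup c k ≡ lookup (corner i) k
    X⊕c≈K k k≢i = trans (sym (lookup-zipWith _⊕_ k X c)) (V≈K k k≢i)
    X≈Y : EqualExcept i X Y
    X≈Y k k≢i = ⊕-injectiveʳ (lookup c k)
      (trans (X⊕c≈K k k≢i) (sym (trans (sym (lookup-zipWith _⊕_ k Y c)) (W≈K k k≢i))))
    c≡shiftFor : c ≡ shiftFor i X
    c≡shiftFor = ⨁-determines i
      (λ k k≢i → trans (sym (⊕-cancelˡ (lookup X k) (lookup c k)))
                       (trans (cong (lookup X k ⊕_) (X⊕c≈K k k≢i)) (sym (lookup-shiftFor X k≢i))))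
      (trans ⨁c≡ (sym (⨁-shiftFor i X)))
    cᵢ≡κ : lookup c i ≡ ⨁-except X i
    cᵢ≡κ = trans (cong (λ d → lookup d i) c≡shiftFor) (lookup∘update i (zipWith _⊕_ X (corner i)) _)
    X⊕c′ : ∀ Z → lookup (zipWith _⊕_ Z c) i ≡ lookup Z i ⊕ ⨁-except X i
    X⊕c′ Z = trans (lookup-zipWith _⊕_ i Z c) (cong (lookup Z i ⊕_) cᵢ≡κ)

module ZigzagDecomposition {m s N t′ : ℕ} (P : Fin N → Path m s) (D : IsPathDecomposition P) where

  private
    t = suc t′

  module Z (j : Fin N) = Zigzag {m} {s} {t} (P j)

  -- The first block of a shift is forced by ⨁ c ≡ cornerSum; the other t′ blocks are free.
  shift : Fin N → Blocks m t′ → Blocks m t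
  shift j U = (Z.cornerSum j ⊕ ⨁ U) ∷ U

  ⨁-shift : ∀ j U → ⨁ (shift j U) ≡ Z.cornerSum j
  ⨁-shift j U = ⊕-cancelʳ (Z.cornerSum j) (⨁ U)

  shift-tail : ∀ j (c : Blocks m t) → ⨁ c ≡ Z.cornerSum j → shift j (tail c) ≡ c
  shift-tail j (x ∷ U) ⨁c≡ = cong (_∷ U) (sym (⊕-moveʳ ⨁c≡))

  shiftedZigzag : Fin N × Blocks m t′ → Path (t * m) (t * s)
  shiftedZigzag (j , U) = translate (concat (shift j U)) (Z.zigzag j)

  module _ (X Y : Blocks m t) (adj : Adjacent (concat X) (concat Y)) where

    private
      moving = concat-adjacent⁻ X Y adj
      i₀ = proj₁ moving
      X≈Y = proj₂ (proj₂ moving)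
      κ = ⨁-except X i₀
      D₀ = D (lookup X i₀ ⊕ κ) (lookup Y i₀ ⊕ κ) (Adjacent-⊕ {x = lookup X i₀} κ (proj₁ (proj₂ moving)))

    covered : Σ (Fin N × Blocks m t′) λ ι → Σ (Fin (t * s)) λ e → EdgeAt (shiftedZigzag ι) e (concat X) (concat Y)
    covered with proj₁ D₀
    ... | j , r̂ , e with alternate-hasEdge (toℕ i₀) (P j) (r̂ , e)
    ...   | r , e′ = (j , tail c) , combine i₀ r ,
                     subst (λ d → EdgeAt (translate (concat d) (Z.zigzag j)) (combine i₀ r) (concat X) (concat Y))
                           (sym (shift-tail j c (Z.⨁-shiftFor j i₀ X))) (Z.translate-zigzag-edge j {X = X} {Y} X≈Y e′)
      where c = Z.shiftFor j i₀ X

    coveredOnce : ∀ ι ι′ e e′ → EdgeAt (shiftedZigzag ι) e (concat X) (concat Y) →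
                  EdgeAt (shiftedZigzag ι′) e′ (concat X) (concat Y) → ι ≡ ι′ × e ≡ e′
    coveredOnce (j , U) (j′ , U′) e e′ o o′
      with combine-surjective {t} {s} e | combine-surjective {t} {s} e′
    ... | i , r , refl | i′ , r′ , refl
      with Z.translate-zigzag-edge⁻ j {i} {r} {X} {Y} {shift j U} (⨁-shift j U) o
         | Z.translate-zigzag-edge⁻ j′ {i′} {r′} {X} {Y} {shift j′ U′} (⨁-shift j′ U′) o′
    ... | X≈Yᵢ , shift≡ , mov | X≈Yᵢ′ , shift′≡ , mov′
      with refl ← equalExcept-unique {X = X} {Y} {i} {i₀} X≈Yᵢ X≈Y (Adjacent⇒≢ adj ∘ cong concat)
         | refl ← equalExcept-unique {X = X} {Y} {i′} {i₀} X≈Yᵢ′ X≈Y (Adjacent⇒≢ adj ∘ cong concat)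
      with refl , _ ← proj₂ D₀ j j′ _ _ (proj₂ (alternate-hasEdge⁻ (toℕ i₀) (P j) (r , mov)))
                                        (proj₂ (alternate-hasEdge⁻ (toℕ i₀) (P j′) (r′ , mov′)))
      with refl ← cong tail (trans shift≡ (sym shift′≡))
      = refl , edgeAt-unique (shiftedZigzag (j , U)) o o′

  zigzag-decomposition : IsDecomposition shiftedZigzag
  zigzag-decomposition x y adj with group t m x | group t m y
  ... | X , refl | Y , refl = covered X Y adj , coveredOnce X Y adj

decomposable-* : ∀ {m s} t → .{{_ : NonZero t}} → Decomposable m s → Decomposable (t * m) (t * s)
decomposable-* {m} (suc t′) (N , P , D) = isDecomposition⇒decomposable {P = shiftedZigzag} index↔ zigzag-decomposition
  where
  open ZigzagDecomposition {t′ = t′} P D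
  index↔ : (Fin N × Blocks m t′) ↔ Fin (N * (2 ^ m) ^ t′)
  index↔ = ↔-trans (↔-refl ×-↔ Vec↔Fin^ (Vec↔Fin^ (↔-sym 2↔Bool) m) t′) (↔-sym *↔×)

lemma2p2 : ∀ (n t s : ℕ) → .{{_ : NonZero t}} → 0 < n → ¬ (2 ∣ t) → t ∣ n →
    Decomposable (n / t) s → Decomposable n (t * s)
lemma2p2 n t s _ _ (divides q refl) d =
  subst (λ n → Decomposable n (t * s)) (*-comm t q) (decomposable-* t (subst (λ n → Decomposable n s) (m*n/n≡m q t) d))
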